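{- Let $Y$ be a simple connected $(a,b)$-biregular graph with $a<b$ and $a+b=8$. Then its line graph $L(Y)$ has a triangle decomposition if and only if $Y = K_{1,7}$.
   Context: An $(a,b)$-biregular (bipartite $(a,b)$-semiregular) graph is a bipartite graph with a bipartition $(U,W)$ in which every vertex of $U$ has degree $a$ and every vertex of $W$ has degree $b$. The line graph $L(Y)$ has the edges of $Y$ as vertices, two being adjacent when they share an endpoint. A triangle decomposition of a graph is a partition of its edge set into edge-disjoint triangles. -}

module Defs where

open import Data.Nat using (ℕ)
open import Data.Bool using (Bool; true; false)
open import Data.Fin using (Fin; zero; suc) renaming (_<_ to _<ᶠ_)
open import Data.List using (List; length; filterᵇ; lookup)
open import Data.List.Base using (allFin)
open import Data.Product using (Σ; _×_; _,_; ∃)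
open import Data.Sum using (_⊎_)
open import Relation.Binary.PropositionalEquality using (_≡_; _≢_)
open import Function.Bundles using (_↔_; Inverse)

record Graph (n : ℕ) : Set where
  field
    adj    : Fin n → Fin n → Bool
    sym    : ∀ i j → adj i j ≡ adj j i
    irrefl : ∀ i → adj i i ≡ false
open Graph public

module _ {n : ℕ} (G : Graph n) where

  Adj : Fin n → Fin n → Set
  Adj i j = adj G i j ≡ true

  degree : Fin n → ℕ
  degree i = length (filterᵇ (adj G i) (allFin n))

  data Reach : Fin n → Fin n → Set where
    here : ∀ {i} → Reach i i
    step : ∀ {i j k} → Adj i j → Reach j k → Reach i k

  -- connected graphs are nonempty by convention
  Connected : Set
  Connected = Fin n × (∀ i j → Reach i j)

  -- (a,b)-biregular: a bipartition (U,W) (U = side true, W = side false),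
  -- both parts nonempty, every edge joins U and W, U-vertices have degree a,
  -- W-vertices have degree b.
  Biregular : ℕ → ℕ → Set
  Biregular a b = Σ (Fin n → Bool) λ side →
      (∃ λ u → side u ≡ true) × (∃ λ w → side w ≡ false)
    × (∀ i j → Adj i j → side i ≢ side j)
    × (∀ i → side i ≡ true → degree i ≡ a)
    × (∀ i → side i ≡ false → degree i ≡ b)

  -- An edge of G, represented canonically as an ordered pair (i , j) with i < j.
  Pair : Set
  Pair = Fin n × Fin n

  IsEdge : Pair → Set
  IsEdge (i , j) = (i <ᶠ j) × Adj i j

  Share : Pair → Pair → Set
  Share (i , j) (k , l) = (i ≡ k ⊎ i ≡ l) ⊎ (j ≡ k ⊎ j ≡ l)

  LAdj : Pair → Pair → Set
  LAdj e f = IsEdge e × IsEdge f × e ≢ f × Share e f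

  record Triangle : Set where
    field
      e₁ e₂ e₃ : Pair
      a₁₂ : LAdj e₁ e₂
      a₁₃ : LAdj e₁ e₃
      a₂₃ : LAdj e₂ e₃

  _∈T_ : Pair → Triangle → Set
  e ∈T t = e ≡ Triangle.e₁ t ⊎ e ≡ Triangle.e₂ t ⊎ e ≡ Triangle.e₃ t

  Covers : Triangle → Pair → Pair → Set
  Covers t e f = (e ∈T t) × (f ∈T t)

  TriangleDecomposition : Set
  TriangleDecomposition = Σ (List Triangle) λ ts →
    ∀ e f → LAdj e f →
      Σ (Fin (length ts)) λ k → Covers (lookup ts k) e f
        × (∀ k′ → Covers (lookup ts k′) e f → k′ ≡ k)

Iso : ∀ {n m} → Graph n → Graph m → Set
Iso {n} {m} G H = Σ (Fin n ↔ Fin m) λ f →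
  ∀ i j → adj G i j ≡ adj H (Inverse.to f i) (Inverse.to f j)

K17adj : Fin 8 → Fin 8 → Bool
K17adj zero zero = false
K17adj zero (suc _) = true
K17adj (suc _) zero = true
K17adj (suc _) (suc _) = false

K17 : Graph 8
K17 = record { adj = K17adj ; sym = s ; irrefl = r }
  where
  open import Relation.Binary.PropositionalEquality using (refl)
  s : ∀ i j → K17adj i j ≡ K17adj j i
  s zero zero = refl
  s zero (suc _) = refl
  s (suc _) zero = refl
  s (suc _) (suc _) = refl
  r : ∀ i → K17adj i i ≡ false
  r zero = refl
  r (suc _) = refl

-- In a triangle-free (e.g. bipartite) graph three pairwise intersecting edges
-- share a vertex, so a triangle decomposition of L(Y) induces at every vertex w a Steiner
-- triple system on the neighbours of w. No such system has 2, 4 or 5 points, so no vertex has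
-- degree 2 or 5, which excludes (a, b) = (2, 6) and (3, 5); these Y have minimum degree 2, so
-- they are not K₁,₇ either. The case a = 0 contradicts connectivity. For (a, b) = (1, 7)
-- connectivity forces Y to be a star on 8 vertices, and the seven lines of the Fano plane
-- decompose its line graph K₇.

module Submission where

open import Defs
open import Data.Nat using (ℕ; _+_; _<_)
open import Relation.Binary.PropositionalEquality using (_≡_)
open import Function.Bundles using (_⇔_)

open import Data.Bool using (Bool; true; false; not; T?)
open import Data.Bool.Properties using (¬-not; T-≡; ⇔→≡)
open import Data.Empty using (⊥; ⊥-elim)
open import Data.Fin using (Fin; zero; suc; punchIn; punchOut; cast; #_)
open import Data.Fin.Permutation using (transpose; _⟨$⟩ʳ_; _⟨$⟩ˡ_; inverseˡ)
open import Data.Fin.Properties as Finₚ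
  using (_≟_; <-cmp; <-asym; punchInᵢ≢i; punchIn-injective; punchIn-punchOut; cast-involutive)
open import Data.List using (List; []; _∷_; _++_; length; filterᵇ; allFin; tabulate; lookup)
open import Data.List.Properties using (length-++; length-tabulate; lookup-tabulate)
open import Data.List.Membership.Propositional using (_∈_; _∉_; find; lose)
open import Data.List.Membership.Propositional.Properties
  using (∈-∃++; ∈-++⁻; ∈-++⁺ˡ; ∈-++⁺ʳ; ∈-filter⁺; ∈-filter⁻; ∈-allFin)
open import Data.List.Relation.Binary.Subset.Propositional using (_⊆_)
open import Data.List.Relation.Unary.All as All using (All; []; _∷_)
open import Data.List.Relation.Unary.All.Properties using (¬Any⇒All¬)
open import Data.List.Relation.Unary.AllPairs using ([]; _∷_)
open import Data.List.Relation.Unary.Any as Any using (here; there)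
open import Data.List.Relation.Unary.Unique.Propositional using (Unique)
open import Data.List.Relation.Unary.Unique.Propositional.Properties using (allFin⁺; filter⁺)
open import Data.Nat using (suc; _≤_; z≤n; s≤s)
open import Data.Nat.Properties
  using ( ≤-refl; ≤-trans; ≤-reflexive; ≤-antisym; <⇒≱; ≰⇒>; <-irrefl; ≤-<-trans
        ; +-mono-≤; +-monoʳ-<; +-suc; m+n≮m; n≮0; n≤1+n; module ≤-Reasoning)
open import Data.Product using (Σ; ∃; ∃₂; _×_; _,_; proj₁; proj₂)
open import Data.Product.Function.NonDependent.Propositional using (_×-⇔_)
open import Data.Sum as Sum using (_⊎_; inj₁; inj₂; [_,_])
open import Data.Sum.Function.Propositional using (_⊎-⇔_)
import Data.Vec as Vec
open import Function using (_∘_; id)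
open import Function.Bundles using (Inverse; Injection; Equivalence; mk⇔)
open import Function.Properties.Inverse using (Inverse⇒Injection)
import Function.Properties.Equivalence as ⇔
open import Function.Related.TypeIsomorphisms using (¬-cong-⇔)
open import Relation.Binary.Definitions using (DecidableEquality; tri<; tri≈; tri>)
open import Relation.Binary.PropositionalEquality as ≡ using (refl; cong; subst; _≢_; ≢-sym)
open import Relation.Nullary using (¬_; Dec; yes; no; ¬?; contradiction)
open import Relation.Nullary.Decidable using (_×-dec_; _⊎-dec_; _→-dec_; from-yes; decidable-stable)

∈-++-∷⁻ : {A : Set} {x y : A} (ys₁ : List A) {ys₂ : List A} →
          y ∈ ys₁ ++ x ∷ ys₂ → y ≢ x → y ∈ ys₁ ++ ys₂
∈-++-∷⁻ ys₁ y∈ y≢x with ∈-++⁻ ys₁ y∈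
... | inj₁ y∈ys₁         = ∈-++⁺ˡ y∈ys₁
... | inj₂ (here y≡x)    = contradiction y≡x y≢x
... | inj₂ (there y∈ys₂) = ∈-++⁺ʳ ys₁ y∈ys₂

unique-⊆⇒length≤ : {A : Set} {xs ys : List A} → Unique xs → xs ⊆ ys → length xs ≤ length ys
unique-⊆⇒length≤ {xs = []} _ _ = z≤n
unique-⊆⇒length≤ {xs = x ∷ xs} (x≢xs ∷ xs-unique) xs⊆ys
  with ys₁ , ys₂ , refl ← ∈-∃++ (xs⊆ys (here refl)) = begin
    suc (length xs)                ≤⟨ s≤s (unique-⊆⇒length≤ xs-unique xs⊆ys₁++ys₂) ⟩
    suc (length (ys₁ ++ ys₂))      ≡⟨ cong suc (length-++ ys₁) ⟩
    suc (length ys₁ + length ys₂)  ≡⟨ +-suc (length ys₁) (length ys₂) ⟨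
    length ys₁ + suc (length ys₂)  ≡⟨ length-++ ys₁ ⟨
    length (ys₁ ++ x ∷ ys₂)        ∎
  where
  open ≤-Reasoning
  xs⊆ys₁++ys₂ : xs ⊆ ys₁ ++ ys₂
  xs⊆ys₁++ys₂ y∈xs = ∈-++-∷⁻ ys₁ (xs⊆ys (there y∈xs)) (≢-sym (All.lookup x≢xs y∈xs))

module _ {A : Set} (_≟ᴬ_ : DecidableEquality A) where
  open import Data.List.Membership.DecPropositional _≟ᴬ_ using (_∈?_)

  unique-longer⇒∃∉ : {xs ys : List A} → Unique xs → length ys < length xs →
                     ∃ λ x → x ∈ xs × x ∉ ys
  unique-longer⇒∃∉ {xs} {ys} xs-unique ys<xs with Any.any? (λ x → ¬? (x ∈? ys)) xs
  ... | yes some∉ys = find some∉ys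
  ... | no none∉ys  = contradiction (unique-⊆⇒length≤ xs-unique xs⊆ys) (<⇒≱ ys<xs)
    where
    xs⊆ys : xs ⊆ ys
    xs⊆ys {x} x∈xs = decidable-stable (x ∈? ys) (none∉ys ∘ lose x∈xs)

Bool-pigeonhole : {x y z : Bool} → x ≢ y → y ≢ z → x ≢ z → ⊥
Bool-pigeonhole x≢y y≢z x≢z = x≢z (≡.trans (¬-not x≢y) (≡.sym (¬-not (≢-sym y≢z))))

smaller-part< : ∀ {a b k} → a < b → a + b ≡ k + k → a < k
smaller-part< {a} {b} {k} a<b a+b≡k+k = ≰⇒> λ k≤a →
  <-irrefl refl (≤-<-trans (+-mono-≤ k≤a k≤a) (subst (a + a <_) a+b≡k+k (+-monoʳ-< a a<b)))

TriangleFree : ∀ {n} → Graph n → Set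
TriangleFree G = ∀ {i j k} → Adj G i j → Adj G j k → Adj G i k → ⊥

AtMostOneNeighbour : ∀ {n} → Graph n → Fin n → Set
AtMostOneNeighbour G i = ∀ {x y} → Adj G i x → Adj G i y → x ≡ y

module _ {n : ℕ} (G : Graph n) where

  Adj-sym : ∀ {i j} → Adj G i j → Adj G j i
  Adj-sym {i} {j} ij = ≡.trans (Graph.sym G j i) ij

  Adj⇒≢ : ∀ {i j} → Adj G i j → i ≢ j
  Adj⇒≢ {i} ii refl = contradiction (≡.trans (≡.sym (Graph.irrefl G i)) ii) λ ()

  neighbours : Fin n → List (Fin n)
  neighbours i = filterᵇ (adj G i) (allFin n)

  ∈-neighbours⁺ : ∀ {i x} → Adj G i x → x ∈ neighbours i
  ∈-neighbours⁺ {i} {x} ix = ∈-filter⁺ (T? ∘ adj G i) (∈-allFin x) (Equivalence.from T-≡ ix)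

  ∈-neighbours⁻ : ∀ {i x} → x ∈ neighbours i → Adj G i x
  ∈-neighbours⁻ {i} x∈ = Equivalence.to T-≡ (proj₂ (∈-filter⁻ (T? ∘ adj G i) {xs = allFin n} x∈))

  neighbours-unique : ∀ i → Unique (neighbours i)
  neighbours-unique i = filter⁺ (T? ∘ adj G i) (allFin⁺ n)

  distinct-neighbours≤degree : ∀ {i xs} → Unique xs → All (Adj G i) xs → length xs ≤ degree G i
  distinct-neighbours≤degree xs-unique i-xs =
    unique-⊆⇒length≤ xs-unique (∈-neighbours⁺ ∘ All.lookup i-xs)

  fresh-neighbour : ∀ {i} xs → length xs < degree G i → ∃ λ x → Adj G i x × All (x ≢_) xs
  fresh-neighbour {i} xs xs<d =
    let x , x∈ , x∉xs = unique-longer⇒∃∉ _≟_ (neighbours-unique i) xs<d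
    in  x , ∈-neighbours⁻ x∈ , ¬Any⇒All¬ xs x∉xs

  two-distinct-neighbours : ∀ {i} → 2 ≤ degree G i → ∃₂ λ u v → Adj G i u × Adj G i v × u ≢ v
  two-distinct-neighbours 2≤d =
    let u , iu , _    = fresh-neighbour [] (≤-trans (s≤s z≤n) 2≤d)
        v , iv , v≢[u] = fresh-neighbour (u ∷ []) 2≤d
    in  u , v , iu , iv , ≢-sym (All.head v≢[u])

  degree<2⇒atMostOneNeighbour : ∀ {i} → degree G i < 2 → AtMostOneNeighbour G i
  degree<2⇒atMostOneNeighbour d<2 {x} {y} ix iy with x ≟ y
  ... | yes x≡y = x≡y
  ... | no  x≢y =
    contradiction (distinct-neighbours≤degree ((x≢y ∷ []) ∷ [] ∷ []) (ix ∷ iy ∷ [])) (<⇒≱ d<2)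

  2≤degree⇒¬atMostOneNeighbour : ∀ {i} → 2 ≤ degree G i → ¬ AtMostOneNeighbour G i
  2≤degree⇒¬atMostOneNeighbour 2≤d atMostOne =
    let _ , _ , iu , iv , u≢v = two-distinct-neighbours 2≤d in u≢v (atMostOne iu iv)

  reach⇒0<degree : ∀ {i j} → Reach G i j → i ≢ j → 0 < degree G i
  reach⇒0<degree here        i≢i = contradiction refl i≢i
  reach⇒0<degree (step ik _) _   = distinct-neighbours≤degree ([] ∷ []) (ik ∷ [])

  Endpoint : Fin n → Pair G → Set
  Endpoint v (i , j) = v ≡ i ⊎ v ≡ j

  Joins : Fin n → Fin n → Pair G → Set
  Joins x y e = e ≡ (x , y) ⊎ e ≡ (y , x)

  edge : Fin n → Fin n → Pair G
  edge x y with <-cmp x y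
  ... | tri< _ _ _ = x , y
  ... | tri≈ _ _ _ = x , y
  ... | tri> _ _ _ = y , x

  edge-joins : ∀ x y → Joins x y (edge x y)
  edge-joins x y with <-cmp x y
  ... | tri< _ _ _ = inj₁ refl
  ... | tri≈ _ _ _ = inj₁ refl
  ... | tri> _ _ _ = inj₂ refl

  edge-isEdge : ∀ {x y} → Adj G x y → IsEdge G (edge x y)
  edge-isEdge {x} {y} xy with <-cmp x y
  ... | tri< x<y _ _ = x<y , xy
  ... | tri≈ _ x≡y _ = contradiction x≡y (Adj⇒≢ xy)
  ... | tri> _ _ y<x = y<x , Adj-sym xy

  joins-unique : ∀ {x y e f} → IsEdge G e → IsEdge G f → Joins x y e → Joins x y f → e ≡ f
  joins-unique _        _        (inj₁ refl) (inj₁ refl) = refl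
  joins-unique (x<y , _) (y<x , _) (inj₁ refl) (inj₂ refl) = contradiction y<x (<-asym x<y)
  joins-unique (y<x , _) (x<y , _) (inj₂ refl) (inj₁ refl) = contradiction x<y (<-asym y<x)
  joins-unique _        _        (inj₂ refl) (inj₂ refl) = refl

  joins-injective : ∀ {w x y e} → Joins w x e → Joins w y e → x ≡ y
  joins-injective (inj₁ refl) (inj₁ refl) = refl
  joins-injective (inj₁ refl) (inj₂ refl) = refl
  joins-injective (inj₂ refl) (inj₁ refl) = refl
  joins-injective (inj₂ refl) (inj₂ refl) = refl

  edge-injectiveʳ : ∀ {w x y} → edge w x ≡ edge w y → x ≡ y
  edge-injectiveʳ {w} {x} {y} wx≡wy =
    joins-injective (edge-joins w x) (subst (Joins w y) (≡.sym wx≡wy) (edge-joins w y))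

  joins⇒endpoint : ∀ {x y e} → Joins x y e → Endpoint x e
  joins⇒endpoint (inj₁ refl) = inj₁ refl
  joins⇒endpoint (inj₂ refl) = inj₂ refl

  endpoint⇒edge : ∀ {w e} → IsEdge G e → Endpoint w e → ∃ λ x → Adj G w x × e ≡ edge w x
  endpoint⇒edge {e = i , j} e-edge@(_ , ij) (inj₁ refl) =
    j , ij , joins-unique e-edge (edge-isEdge ij) (inj₁ refl) (edge-joins i j)
  endpoint⇒edge {e = i , j} e-edge@(_ , ij) (inj₂ refl) =
    i , Adj-sym ij , joins-unique e-edge (edge-isEdge (Adj-sym ij)) (inj₂ refl) (edge-joins j i)

  share-endpoint : ∀ {v} e f → Endpoint v e → Endpoint v f → Share G e f
  share-endpoint _ _ (inj₁ refl) (inj₁ refl) = inj₁ (inj₁ refl)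
  share-endpoint _ _ (inj₁ refl) (inj₂ refl) = inj₁ (inj₂ refl)
  share-endpoint _ _ (inj₂ refl) (inj₁ refl) = inj₂ (inj₁ refl)
  share-endpoint _ _ (inj₂ refl) (inj₂ refl) = inj₂ (inj₂ refl)

  share⇒endpoint : ∀ {w u e} g → Joins w u e → Share G e g → Endpoint w g ⊎ Endpoint u g
  share⇒endpoint _ (inj₁ refl) shared = shared
  share⇒endpoint _ (inj₂ refl) shared = Sum.swap shared

  endpoints⇒Adj : ∀ {u v g} → IsEdge G g → Endpoint u g → Endpoint v g → u ≢ v → Adj G u v
  endpoints⇒Adj _        (inj₁ refl) (inj₁ refl) u≢u = contradiction refl u≢u
  endpoints⇒Adj (_ , uv) (inj₁ refl) (inj₂ refl) _   = uv
  endpoints⇒Adj (_ , vu) (inj₂ refl) (inj₁ refl) _   = Adj-sym vu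
  endpoints⇒Adj _        (inj₂ refl) (inj₂ refl) u≢u = contradiction refl u≢u

  Share-sym : ∀ e f → Share G e f → Share G f e
  Share-sym _ _ (inj₁ (inj₁ refl)) = inj₁ (inj₁ refl)
  Share-sym _ _ (inj₁ (inj₂ refl)) = inj₂ (inj₁ refl)
  Share-sym _ _ (inj₂ (inj₁ refl)) = inj₁ (inj₂ refl)
  Share-sym _ _ (inj₂ (inj₂ refl)) = inj₂ (inj₂ refl)

  LAdj-sym : ∀ {e f} → LAdj G e f → LAdj G f e
  LAdj-sym {e} {f} (e-edge , f-edge , e≢f , shared) = f-edge , e-edge , ≢-sym e≢f , Share-sym e f shared

  edges-LAdj : ∀ {w u v} → Adj G w u → Adj G w v → u ≢ v → LAdj G (edge w u) (edge w v)
  edges-LAdj {w} {u} {v} wu wv u≢v =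
    edge-isEdge wu , edge-isEdge wv , u≢v ∘ edge-injectiveʳ ,
    share-endpoint (edge w u) (edge w v) (joins⇒endpoint (edge-joins w u)) (joins⇒endpoint (edge-joins w v))

  LAdj-edges⇒edge : TriangleFree G → ∀ {w u v} g → Adj G w u → Adj G w v → u ≢ v →
                    LAdj G (edge w u) g → LAdj G (edge w v) g → ∃ λ x → Adj G w x × g ≡ edge w x
  LAdj-edges⇒edge triangle-free {w} {u} {v} g wu wv u≢v (_ , g-edge , _ , shared-u) (_ , _ , _ , shared-v)
    with share⇒endpoint g (edge-joins w u) shared-u | share⇒endpoint g (edge-joins w v) shared-v
  ... | inj₁ w∈g | _        = endpoint⇒edge g-edge w∈g
  ... | inj₂ _   | inj₁ w∈g = endpoint⇒edge g-edge w∈g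
  ... | inj₂ u∈g | inj₂ v∈g = ⊥-elim (triangle-free wu (endpoints⇒Adj g-edge u∈g v∈g u≢v) wv)

  third-member : ∀ {e f} (t : Triangle G) → _∈T_ G e t → _∈T_ G f t → e ≢ f →
                 ∃ λ g → _∈T_ G g t × LAdj G e g × LAdj G f g ×
                         (∀ {h} → _∈T_ G h t → h ≡ e ⊎ h ≡ f ⊎ h ≡ g)
  third-member t (inj₁ refl)        (inj₁ refl)        e≢e = contradiction refl e≢e
  third-member t (inj₂ (inj₁ refl)) (inj₂ (inj₁ refl)) e≢e = contradiction refl e≢e
  third-member t (inj₂ (inj₂ refl)) (inj₂ (inj₂ refl)) e≢e = contradiction refl e≢e
  third-member t (inj₁ refl) (inj₂ (inj₁ refl)) _ =
    e₃ , inj₂ (inj₂ refl) , a₁₃ , a₂₃ , id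
    where open Triangle t
  third-member t (inj₂ (inj₁ refl)) (inj₁ refl) _ =
    e₃ , inj₂ (inj₂ refl) , a₂₃ , a₁₃ , [ inj₂ ∘ inj₁ , [ inj₁ , inj₂ ∘ inj₂ ] ]
    where open Triangle t
  third-member t (inj₁ refl) (inj₂ (inj₂ refl)) _ =
    e₂ , inj₂ (inj₁ refl) , a₁₂ , LAdj-sym a₂₃ , [ inj₁ , [ inj₂ ∘ inj₂ , inj₂ ∘ inj₁ ] ]
    where open Triangle t
  third-member t (inj₂ (inj₂ refl)) (inj₁ refl) _ =
    e₂ , inj₂ (inj₁ refl) , LAdj-sym a₂₃ , a₁₂ , [ inj₂ ∘ inj₁ , [ inj₂ ∘ inj₂ , inj₁ ] ]
    where open Triangle t
  third-member t (inj₂ (inj₁ refl)) (inj₂ (inj₂ refl)) _ =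
    e₁ , inj₁ refl , LAdj-sym a₁₂ , LAdj-sym a₁₃ , [ inj₂ ∘ inj₂ , [ inj₁ , inj₂ ∘ inj₁ ] ]
    where open Triangle t
  third-member t (inj₂ (inj₂ refl)) (inj₂ (inj₁ refl)) _ =
    e₁ , inj₁ refl , LAdj-sym a₁₃ , LAdj-sym a₁₂ , [ inj₂ ∘ inj₂ , [ inj₂ ∘ inj₁ , inj₁ ] ]
    where open Triangle t

module LocalTripleSystem {n} {G : Graph n} (triangle-free : TriangleFree G) (td : TriangleDecomposition G) where

  private
    ts = proj₁ td
    Block = Fin (length ts)

  -- The triple system at w: its points are the neighbours x of w (the edges wx) and its
  -- blocks are the triangles of td.
  OnBlock : Fin n → Block → Fin n → Set
  OnBlock w k x = _∈T_ G (edge G w x) (lookup ts k)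

  record BlockThrough (w u v : Fin n) : Set where
    field
      block      : Block
      apex       : Fin n
      w-apex     : Adj G w apex
      apex≢u     : apex ≢ u
      apex≢v     : apex ≢ v
      block-∋u   : OnBlock w block u
      block-∋v   : OnBlock w block v
      block-∋apex : OnBlock w block apex
      block-⊆    : ∀ {y} → OnBlock w block y → y ≡ u ⊎ y ≡ v ⊎ y ≡ apex

  blockThrough : ∀ {w u v} → Adj G w u → Adj G w v → u ≢ v → BlockThrough w u v
  blockThrough {w} {u} {v} wu wv u≢v
    with k , (u∈k , v∈k) , _ ← proj₂ td _ _ (edges-LAdj G wu wv u≢v)
    with g , g∈k , ug , vg , k-members ← third-member G (lookup ts k) u∈k v∈k (u≢v ∘ edge-injectiveʳ G)
    with x , wx , refl ← LAdj-edges⇒edge G triangle-free g wu wv u≢v ug vg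
    = record
      { block       = k
      ; apex        = x
      ; w-apex      = wx
      ; apex≢u      = λ { refl → proj₁ (proj₂ (proj₂ ug)) refl }
      ; apex≢v      = λ { refl → proj₁ (proj₂ (proj₂ vg)) refl }
      ; block-∋u    = u∈k
      ; block-∋v    = v∈k
      ; block-∋apex = g∈k
      ; block-⊆     = Sum.map (edge-injectiveʳ G) (Sum.map (edge-injectiveʳ G) (edge-injectiveʳ G)) ∘ k-members
      }

  block-unique : ∀ {w u v k k′} → Adj G w u → Adj G w v → u ≢ v →
                 OnBlock w k u → OnBlock w k v → OnBlock w k′ u → OnBlock w k′ v → k ≡ k′
  block-unique wu wv u≢v u∈k v∈k u∈k′ v∈k′ =
    let _ , _ , unique = proj₂ td _ _ (edges-LAdj G wu wv u≢v)
    in  ≡.trans (unique _ (u∈k , v∈k)) (≡.sym (unique _ (u∈k′ , v∈k′)))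

  2≤degree⇒3≤degree : ∀ {w} → 2 ≤ degree G w → 3 ≤ degree G w
  2≤degree⇒3≤degree 2≤d =
    let u , v , wu , wv , u≢v = two-distinct-neighbours G 2≤d
        open BlockThrough (blockThrough wu wv u≢v)
    in  distinct-neighbours≤degree G ((apex≢u ∷ apex≢v ∷ []) ∷ (u≢v ∷ []) ∷ [] ∷ [])
                                     (w-apex ∷ wu ∷ wv ∷ [])

  -- y lies off the block {u, v, x}; the apices z, z′ of the blocks through {u, y} and {v, y}
  -- are new because a block through y meets {u, v, x} at most once.
  six-neighbours : ∀ {w u v y} → Adj G w u → Adj G w v → u ≢ v → (B : BlockThrough w u v) →
                   Adj G w y → All (y ≢_) (BlockThrough.apex B ∷ u ∷ v ∷ []) → 6 ≤ degree G w
  six-neighbours {w} {u} {v} {y} wu wv u≢v B wy (y≢x ∷ y≢u ∷ y≢v ∷ []) =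
    distinct-neighbours≤degree G
      ( (z′≢z ∷ B₃.apex≢v ∷ z′≢x ∷ z′≢u ∷ B₃.apex≢u ∷ [])
      ∷ (B₂.apex≢v ∷ z≢x ∷ B₂.apex≢u ∷ z≢v ∷ [])
      ∷ (y≢x ∷ y≢u ∷ y≢v ∷ [])
      ∷ (x≢u ∷ x≢v ∷ [])
      ∷ (u≢v ∷ [])
      ∷ [] ∷ [])
      (B₃.w-apex ∷ B₂.w-apex ∷ wy ∷ wx ∷ wu ∷ wv ∷ [])
    where
    open BlockThrough B using (block-⊆)
      renaming (block to k; apex to x; w-apex to wx; apex≢u to x≢u; apex≢v to x≢v;
                block-∋u to u∈k; block-∋v to v∈k; block-∋apex to x∈k)
    module B₂ = BlockThrough (blockThrough wu wy (≢-sym y≢u))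
    module B₃ = BlockThrough (blockThrough wv wy (≢-sym y≢v))

    z z′ : Fin n
    z  = B₂.apex
    z′ = B₃.apex

    y∉k : ¬ OnBlock w k y
    y∉k y∈k = [ y≢u , [ y≢v , y≢x ] ] (block-⊆ y∈k)

    meets-k-once : ∀ {k′ p q} → Adj G w p → Adj G w q → p ≢ q →
                   OnBlock w k′ y → OnBlock w k′ p → OnBlock w k′ q →
                   OnBlock w k p → OnBlock w k q → ⊥
    meets-k-once wp wq p≢q y∈k′ p∈k′ q∈k′ p∈k q∈k =
      y∉k (subst (λ j → OnBlock w j y) (block-unique wp wq p≢q p∈k′ q∈k′ p∈k q∈k) y∈k′)

    z≢v : z ≢ v
    z≢v refl = meets-k-once wu wv u≢v B₂.block-∋v B₂.block-∋u B₂.block-∋apex u∈k v∈k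

    z≢x : z ≢ x
    z≢x refl = meets-k-once wu wx (≢-sym x≢u) B₂.block-∋v B₂.block-∋u B₂.block-∋apex u∈k x∈k

    z′≢u : z′ ≢ u
    z′≢u refl = meets-k-once wv wu (≢-sym u≢v) B₃.block-∋v B₃.block-∋u B₃.block-∋apex v∈k u∈k

    z′≢x : z′ ≢ x
    z′≢x refl = meets-k-once wv wx (≢-sym x≢v) B₃.block-∋v B₃.block-∋u B₃.block-∋apex v∈k x∈k

    z′≢z : z′ ≢ z
    z′≢z z′≡z = [ ≢-sym u≢v , [ ≢-sym y≢v , ≢-sym z≢v ] ] (B₂.block-⊆ v∈B₂)
      where
      B₃≡B₂ : B₃.block ≡ B₂.block
      B₃≡B₂ = block-unique wy B₂.w-apex (≢-sym B₂.apex≢v)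
                B₃.block-∋v (subst (OnBlock w B₃.block) z′≡z B₃.block-∋apex)
                B₂.block-∋v B₂.block-∋apex
      v∈B₂ : OnBlock w B₂.block v
      v∈B₂ = subst (λ j → OnBlock w j v) B₃≡B₂ B₃.block-∋u

  4≤degree⇒6≤degree : ∀ {w} → 4 ≤ degree G w → 6 ≤ degree G w
  4≤degree⇒6≤degree 4≤d =
    let u , v , wu , wv , u≢v = two-distinct-neighbours G (≤-trans (s≤s (s≤s z≤n)) 4≤d)
        B = blockThrough wu wv u≢v
        y , wy , y≢xuv = fresh-neighbour G (BlockThrough.apex B ∷ u ∷ v ∷ []) 4≤d
    in  six-neighbours wu wv u≢v B wy y≢xuv

  degree≢2 : ∀ {w} → degree G w ≢ 2
  degree≢2 d≡2 = <-irrefl refl (subst (3 ≤_) d≡2 (2≤degree⇒3≤degree (≤-reflexive (≡.sym d≡2))))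

  degree≢5 : ∀ {w} → degree G w ≢ 5
  degree≢5 d≡5 =
    <-irrefl refl (subst (6 ≤_) d≡5 (4≤degree⇒6≤degree (≤-trans (n≤1+n 4) (≤-reflexive (≡.sym d≡5)))))

record Star {n} (G : Graph n) (c : Fin n) : Set where
  field
    centre-adj : ∀ {i} → i ≢ c → Adj G c i
    at-centre  : ∀ {i j} → Adj G i j → i ≡ c ⊎ j ≡ c

module _ {n} {G : Graph n} where

  leaves⇒star : ∀ {c} → (∀ i j → Reach G i j) → (∀ {i} → Adj G c i → AtMostOneNeighbour G i) →
                Star G c
  leaves⇒star {c} reach leaf = record { centre-adj = centre-adj ; at-centre = at-centre }
    where
    NearCentre : Fin n → Set
    NearCentre i = i ≡ c ⊎ Adj G i c

    near-step : ∀ {i j} → Adj G i j → NearCentre i → NearCentre j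
    near-step ij (inj₁ refl) = inj₂ (Adj-sym G ij)
    near-step ij (inj₂ ic)   = inj₁ (leaf (Adj-sym G ic) ij ic)

    near-along : ∀ {i j} → Reach G i j → NearCentre i → NearCentre j
    near-along here         = id
    near-along (step ij ⇝j) = near-along ⇝j ∘ near-step ij

    near : ∀ i → NearCentre i
    near i = near-along (reach c i) (inj₁ refl)

    centre-adj : ∀ {i} → i ≢ c → Adj G c i
    centre-adj {i} i≢c = [ (λ i≡c → contradiction i≡c i≢c) , Adj-sym G ] (near i)

    at-centre : ∀ {i j} → Adj G i j → i ≡ c ⊎ j ≡ c
    at-centre {i} {j} ij with near i | near j
    ... | inj₁ i≡c | _        = inj₁ i≡c
    ... | inj₂ _   | inj₁ j≡c = inj₂ j≡c
    ... | inj₂ ic  | inj₂ _   = inj₂ (leaf (Adj-sym G ic) ij ic)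

  dominating⇒order : ∀ {c} → (∀ {i} → i ≢ c → Adj G c i) → n ≡ suc (degree G c)
  dominating⇒order {c} c-adj = ≤-antisym
    (subst (_≤ suc (degree G c)) length-allFin (unique-⊆⇒length≤ (allFin⁺ n) allFin⊆))
    (subst (suc (degree G c) ≤_) length-allFin
      (unique-⊆⇒length≤ (c≢neighbours ∷ neighbours-unique G c) (λ {x} _ → ∈-allFin x)))
    where
    length-allFin : length (allFin n) ≡ n
    length-allFin = length-tabulate id
    allFin⊆ : allFin n ⊆ c ∷ neighbours G c
    allFin⊆ {i} _ with i ≟ c
    ... | yes i≡c = here i≡c
    ... | no  i≢c = there (∈-neighbours⁺ G (c-adj i≢c))
    c≢neighbours : All (c ≢_) (neighbours G c)
    c≢neighbours = All.tabulate (Adj⇒≢ G ∘ ∈-neighbours⁻ G)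

  star-leaf : ∀ {c ℓ} → Star G c → ℓ ≢ c → AtMostOneNeighbour G ℓ
  star-leaf {c} {ℓ} star ℓ≢c ℓx ℓy = ≡.trans (at-leaf ℓx) (≡.sym (at-leaf ℓy))
    where
    at-leaf : ∀ {x} → Adj G ℓ x → x ≡ c
    at-leaf ℓx = [ (λ ℓ≡c → contradiction ℓ≡c ℓ≢c) , id ] (Star.at-centre star ℓx)

OneOf : Set → Set → Set
OneOf P Q = (P × ¬ Q) ⊎ (¬ P × Q)

OneOf-cong : ∀ {P P′ Q Q′} → P ⇔ P′ → Q ⇔ Q′ → OneOf P Q ⇔ OneOf P′ Q′
OneOf-cong P⇔P′ Q⇔Q′ = (P⇔P′ ×-⇔ ¬-cong-⇔ Q⇔Q′) ⊎-⇔ (¬-cong-⇔ P⇔P′ ×-⇔ Q⇔Q′)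

star-adj⇔ : ∀ {n} {G : Graph n} {c} → Star G c → ∀ i j → Adj G i j ⇔ OneOf (i ≡ c) (j ≡ c)
star-adj⇔ {G = G} star i j = mk⇔ to from
  where
  open Star star
  to : Adj G i j → OneOf (i ≡ _) (j ≡ _)
  to ij with at-centre ij
  ... | inj₁ refl = inj₁ (refl , ≢-sym (Adj⇒≢ G ij))
  ... | inj₂ refl = inj₂ (Adj⇒≢ G ij , refl)
  from : OneOf (i ≡ _) (j ≡ _) → Adj G i j
  from (inj₁ (refl , j≢c)) = centre-adj j≢c
  from (inj₂ (i≢c , refl)) = Adj-sym G (centre-adj i≢c)

star-iso : ∀ {n} {G H : Graph n} {c d} → Star G c → Star H d → Iso G H
star-iso {G = G} {H} {c} {d} G-star H-star = τ , λ i j → ⇔→≡ (adj⇔ i j)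
  where
  τ = transpose c d

  τc≡d : τ ⟨$⟩ʳ c ≡ d
  τc≡d with c ≟ c
  ... | yes _   = refl
  ... | no  c≢c = contradiction refl c≢c

  τ≡d⇔ : ∀ i → i ≡ c ⇔ τ ⟨$⟩ʳ i ≡ d
  τ≡d⇔ i = mk⇔ (λ { refl → τc≡d }) λ τi≡d → begin
    i                  ≡⟨ inverseˡ τ ⟨
    τ ⟨$⟩ˡ (τ ⟨$⟩ʳ i)  ≡⟨ cong (τ ⟨$⟩ˡ_) (≡.trans τi≡d (≡.sym τc≡d)) ⟩
    τ ⟨$⟩ˡ (τ ⟨$⟩ʳ c)  ≡⟨ inverseˡ τ ⟩
    c                  ∎
    where open ≡.≡-Reasoning

  adj⇔ : ∀ i j → Adj G i j ⇔ Adj H (τ ⟨$⟩ʳ i) (τ ⟨$⟩ʳ j)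
  adj⇔ i j = ⇔.trans (star-adj⇔ G-star i j)
               (⇔.trans (OneOf-cong (τ≡d⇔ i) (τ≡d⇔ j)) (⇔.sym (star-adj⇔ H-star _ _)))

Iso-reflects-atMostOneNeighbour : ∀ {n m} {G : Graph n} {H : Graph m} ((f , f-adj) : Iso G H) →
  ∀ v → AtMostOneNeighbour H (Inverse.to f v) → AtMostOneNeighbour G v
Iso-reflects-atMostOneNeighbour (f , f-adj) v atMostOne {x} {y} vx vy =
  Injection.injective (Inverse⇒Injection f)
    (atMostOne (≡.trans (≡.sym (f-adj v x)) vx) (≡.trans (≡.sym (f-adj v y)) vy))

K17-star : Star K17 zero
K17-star = record { centre-adj = centre-adj ; at-centre = at-centre }
  where
  centre-adj : ∀ {i} → i ≢ zero → Adj K17 zero i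
  centre-adj {zero}  0≢0 = contradiction refl 0≢0
  centre-adj {suc _} _   = refl
  at-centre : ∀ {i j} → Adj K17 i j → i ≡ zero ⊎ j ≡ zero
  at-centre {zero}          _ = inj₁ refl
  at-centre {suc _} {zero}  _ = inj₂ refl
  at-centre {suc _} {suc _} ()

¬Iso-K17 : ∀ {n} {G : Graph n} → (∀ i → 2 ≤ degree G i) → ¬ Iso G K17
¬Iso-K17 {G = G} 2≤degree iso@(f , _) =
  2≤degree⇒¬atMostOneNeighbour G (2≤degree v) (Iso-reflects-atMostOneNeighbour {G = G} {H = K17} iso v v↦leaf)
  where
  v = Inverse.from f (suc zero)
  v↦leaf : AtMostOneNeighbour K17 (Inverse.to f v)
  v↦leaf = subst (AtMostOneNeighbour K17) (≡.sym (Inverse.strictlyInverseˡ f (suc zero)))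
                 (star-leaf K17-star λ ())

-- length (tabulate T) is only propositionally equal to b, hence the casts between indices.
decomposition-from-family : ∀ {n} {G : Graph n} {b} (T : Fin b → Triangle G) →
  (∀ e f → LAdj G e f → Σ (Fin b) λ k → Covers G (T k) e f × (∀ k′ → Covers G (T k′) e f → k′ ≡ k)) →
  TriangleDecomposition G
decomposition-from-family {G = G} {b} T covered-once = tabulate T , λ e f ef →
  let k , T-covers , unique = covered-once e f ef
  in  position k , subst (λ t → Covers G t e f) (≡.sym (lookup-tabulate T k)) T-covers ,
      λ i covers →
        ≡.trans (≡.sym (position-index i)) (cong position (unique (index i) (lookup-covers i covers)))
  where
  position : ∀ k → Fin (length (tabulate T))
  position = cast (≡.sym (length-tabulate T))
  index : Fin (length (tabulate T)) → Fin b
  index = cast (length-tabulate T)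
  position-index : ∀ i → position (index i) ≡ i
  position-index = cast-involutive (≡.sym (length-tabulate T)) (length-tabulate T)
  lookup-covers : ∀ {e f} i → Covers G (lookup (tabulate T) i) e f → Covers G (T (index i)) e f
  lookup-covers {e} {f} i = subst (λ t → Covers G t e f)
    (≡.trans (cong (lookup (tabulate T)) (≡.sym (position-index i))) (lookup-tabulate T (index i)))

Triple : ℕ → Set
Triple v = Fin v × Fin v × Fin v

_∈₃_ : ∀ {v} → Fin v → Triple v → Set
p ∈₃ (x , y , z) = p ≡ x ⊎ p ≡ y ⊎ p ≡ z

_∈₃?_ : ∀ {v} (p : Fin v) (t : Triple v) → Dec (p ∈₃ t)
p ∈₃? (x , y , z) = (p ≟ x) ⊎-dec (p ≟ y) ⊎-dec (p ≟ z)

Distinct₃ : ∀ {v} → Triple v → Set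
Distinct₃ (x , y , z) = x ≢ y × x ≢ z × y ≢ z

distinct₃? : ∀ {v} (t : Triple v) → Dec (Distinct₃ t)
distinct₃? (x , y , z) = ¬? (x ≟ y) ×-dec ¬? (x ≟ z) ×-dec ¬? (y ≟ z)

record SteinerTripleSystem (v : ℕ) : Set where
  field
    size            : ℕ
    triple          : Fin size → Triple v
    triple-distinct : ∀ k → Distinct₃ (triple k)
    unique-triple   : ∀ {p q} → p ≢ q →
      Σ (Fin size) λ k → (p ∈₃ triple k × q ∈₃ triple k) ×
                         (∀ k′ → p ∈₃ triple k′ × q ∈₃ triple k′ → k′ ≡ k)

-- Translates of the perfect difference set {0, 1, 3} modulo 7.
fanoLine : Fin 7 → Triple 7
fanoLine = Vec.lookup
  ( (# 0 , # 1 , # 3) Vec.∷ (# 1 , # 2 , # 4) Vec.∷ (# 2 , # 3 , # 5) Vec.∷ (# 3 , # 4 , # 6)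
  Vec.∷ (# 4 , # 5 , # 0) Vec.∷ (# 5 , # 6 , # 1) Vec.∷ (# 6 , # 0 , # 2) Vec.∷ Vec.[])

fano : SteinerTripleSystem 7
fano = record
  { size            = 7
  ; triple          = fanoLine
  ; triple-distinct = from-yes (Finₚ.all? λ k → distinct₃? (fanoLine k))
  ; unique-triple   = λ {p} {q} → from-yes (Finₚ.all? λ p → Finₚ.all? λ q → ¬? (p ≟ q) →-dec
      Finₚ.any? λ k → ((p ∈₃? fanoLine k) ×-dec (q ∈₃? fanoLine k)) ×-dec
        Finₚ.all? λ k′ → ((p ∈₃? fanoLine k′) ×-dec (q ∈₃? fanoLine k′)) →-dec (k′ ≟ k)) p q
  }

module _ {m} {G : Graph (suc m)} {c} (star : Star G c) where
  open Star star

  spoke : Fin m → Pair G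
  spoke ℓ = edge G c (punchIn c ℓ)

  spoke-≡⇔ : ∀ {ℓ ℓ′} → spoke ℓ ≡ spoke ℓ′ ⇔ ℓ ≡ ℓ′
  spoke-≡⇔ = mk⇔ (punchIn-injective c _ _ ∘ edge-injectiveʳ G) (cong spoke)

  spokes-LAdj : ∀ {ℓ ℓ′} → ℓ ≢ ℓ′ → LAdj G (spoke ℓ) (spoke ℓ′)
  spokes-LAdj ℓ≢ℓ′ = edges-LAdj G (centre-adj (punchInᵢ≢i c _)) (centre-adj (punchInᵢ≢i c _))
                                  (ℓ≢ℓ′ ∘ punchIn-injective c _ _)

  edge⇒spoke : ∀ {e} → IsEdge G e → ∃ λ ℓ → e ≡ spoke ℓ
  edge⇒spoke {i , j} e-edge@(_ , ij) =
    let x , cx , e≡cx = endpoint⇒edge G {w = c} e-edge ([ inj₁ ∘ ≡.sym , inj₂ ∘ ≡.sym ] (at-centre ij))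
        c≢x = Adj⇒≢ G cx
    in  punchOut c≢x , ≡.trans e≡cx (cong (edge G c) (≡.sym (punchIn-punchOut c≢x)))

  spokeTriangle : (t : Triple m) → Distinct₃ t → Triangle G
  spokeTriangle (p , q , r) (p≢q , p≢r , q≢r) = record
    { e₁ = spoke p ; e₂ = spoke q ; e₃ = spoke r
    ; a₁₂ = spokes-LAdj p≢q ; a₁₃ = spokes-LAdj p≢r ; a₂₃ = spokes-LAdj q≢r }

  spoke-∈T⇔ : ∀ {ℓ} t (t-distinct : Distinct₃ t) →
              _∈T_ G (spoke ℓ) (spokeTriangle t t-distinct) ⇔ ℓ ∈₃ t
  spoke-∈T⇔ _ _ = spoke-≡⇔ ⊎-⇔ spoke-≡⇔ ⊎-⇔ spoke-≡⇔

  star-triangleDecomposition : SteinerTripleSystem m → TriangleDecomposition G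
  star-triangleDecomposition S = decomposition-from-family T covered-once
    where
    open SteinerTripleSystem S
    T : Fin size → Triangle G
    T k = spokeTriangle (triple k) (triple-distinct k)
    ∈T⇔ : ∀ {ℓ} k → _∈T_ G (spoke ℓ) (T k) ⇔ ℓ ∈₃ triple k
    ∈T⇔ k = spoke-∈T⇔ (triple k) (triple-distinct k)
    covered-once : ∀ e f → LAdj G e f →
                   Σ (Fin size) λ k → Covers G (T k) e f × (∀ k′ → Covers G (T k′) e f → k′ ≡ k)
    covered-once e f (e-edge , f-edge , e≢f , _)
      with p , refl ← edge⇒spoke e-edge | q , refl ← edge⇒spoke f-edge =
      let k , (p∈k , q∈k) , unique = unique-triple (e≢f ∘ cong spoke)
      in  k , (Equivalence.from (∈T⇔ k) p∈k , Equivalence.from (∈T⇔ k) q∈k) ,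
          λ k′ (p∈k′ , q∈k′) →
            unique k′ (Equivalence.to (∈T⇔ k′) p∈k′ , Equivalence.to (∈T⇔ k′) q∈k′)

star₈⇒Iso-K17×decomposition : ∀ {n} {G : Graph n} {c} → Star G c → n ≡ 8 →
                              Iso G K17 × TriangleDecomposition G
star₈⇒Iso-K17×decomposition star refl = star-iso star K17-star , star-triangleDecomposition star fano

module _ {n} (G : Graph n) {a b : ℕ} where

  biregular⇒triangleFree : Biregular G a b → TriangleFree G
  biregular⇒triangleFree (_ , _ , _ , bipartite , _) ij jk ik =
    Bool-pigeonhole (bipartite _ _ ij) (bipartite _ _ jk) (bipartite _ _ ik)

  biregular-degree : Biregular G a b → ∀ i → degree G i ≡ a ⊎ degree G i ≡ b
  biregular-degree (side , _ , _ , _ , degree-U , degree-W) i with side i in side-i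
  ... | true  = inj₁ (degree-U i side-i)
  ... | false = inj₂ (degree-W i side-i)

  biregular-minDegree : Biregular G a b → 2 ≤ a → 2 ≤ b → ∀ i → 2 ≤ degree G i
  biregular-minDegree B 2≤a 2≤b i =
    [ (λ d≡a → subst (2 ≤_) (≡.sym d≡a) 2≤a) , (λ d≡b → subst (2 ≤_) (≡.sym d≡b) 2≤b) ]
      (biregular-degree B i)

  biregular-vertices : Biregular G a b → ∃₂ λ u w → u ≢ w × degree G u ≡ a × degree G w ≡ b ×
                                                   (∀ {i} → Adj G w i → degree G i ≡ a)
  biregular-vertices (side , (u , u∈U) , (w , w∈W) , bipartite , degree-U , degree-W) =
    u , w , u≢w , degree-U u u∈U , degree-W w w∈W ,
    λ {i} wi → degree-U i (≡.trans (¬-not (≢-sym (bipartite w i wi))) (cong not w∈W))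
    where
    u≢w : u ≢ w
    u≢w u≡w = contradiction (≡.trans (≡.sym u∈U) (≡.trans (cong side u≡w) w∈W)) λ ()

biregular-1⇒star : ∀ {n} {G : Graph n} {b} → (∀ i j → Reach G i j) → Biregular G 1 b →
                   ∃ λ c → Star G c × degree G c ≡ b
biregular-1⇒star {G = G} reach B =
  let _ , w , _ , _ , degree-w , degree-neighbour = biregular-vertices G B
  in  w , leaves⇒star reach (degree<2⇒atMostOneNeighbour G ∘ ≤-reflexive ∘ cong suc ∘ degree-neighbour) ,
      degree-w

mainTheorem3 : ∀ {n} (Y : Graph n) (a b : ℕ) → Connected Y → Biregular Y a b
    → a < b → a + b ≡ 8
    → (TriangleDecomposition Y ⇔ Iso Y K17)
mainTheorem3 Y 0 _ (_ , reach) B _ refl =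
  let u , w , u≢w , degree-u , _ = biregular-vertices Y B
  in  ⊥-elim (n≮0 (subst (0 <_) degree-u (reach⇒0<degree Y (reach u w) u≢w)))
mainTheorem3 Y 1 _ (_ , reach) B _ refl =
  let c , star , degree-c = biregular-1⇒star reach B
      order≡8 = ≡.trans (dominating⇒order {G = Y} (Star.centre-adj star)) (cong suc degree-c)
      Y≅K17 , decomposition = star₈⇒Iso-K17×decomposition star order≡8
  in  mk⇔ (λ _ → Y≅K17) (λ _ → decomposition)
mainTheorem3 Y 2 _ _ B _ refl =
  let u , _ , _ , degree-u , _ = biregular-vertices Y B
  in  mk⇔ (λ td → ⊥-elim (LocalTripleSystem.degree≢2 (biregular⇒triangleFree Y B) td degree-u))
          (⊥-elim ∘ ¬Iso-K17 {G = Y} (biregular-minDegree Y B ≤-refl (s≤s (s≤s z≤n))))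
mainTheorem3 Y 3 _ _ B _ refl =
  let _ , w , _ , _ , degree-w , _ = biregular-vertices Y B
  in  mk⇔ (λ td → ⊥-elim (LocalTripleSystem.degree≢5 (biregular⇒triangleFree Y B) td degree-w))
          (⊥-elim ∘ ¬Iso-K17 {G = Y} (biregular-minDegree Y B (s≤s (s≤s z≤n)) (s≤s (s≤s z≤n))))
mainTheorem3 Y (suc (suc (suc (suc a)))) _ _ _ a<b a+b≡8 =
  ⊥-elim (m+n≮m 4 a (smaller-part< {k = 4} a<b a+b≡8))
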